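{- Let $U_1,\dots,U_n$ be ultrafilters on $\omega$ and let $I=(U_1\cap\cdots\cap U_n)^*$. Then for each $1\le i\le n$, $U_i$ has the $I$-pseudo intersection property: for every sequence $\langle X_k:k<\omega\rangle$ of elements of $U_i$ there is $X\in U_i$ such that $X\setminus X_k\in I$ for every $k<\omega$. In particular, $U_i^\omega\le_T U_i\times I^\omega$ for each $i$.
   Context: For a filter $F$ on $\omega$, $F^*=\{\omega\setminus A:A\in F\}$ is its dual ideal; ideals are ordered by inclusion and ultrafilters by reverse inclusion; $P^\omega$ and products are ordered coordinatewise. $P\le_T Q$ (Tukey) means there is a map $Q\to P$ sending cofinal subsets to cofinal subsets. -}

module Defs where


open import Data.Nat using (ℕ)
open import Data.Fin using (Fin)
open import Data.Product using (Σ; ∃; _×_; _,_; proj₁; proj₂)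
open import Data.Sum using (_⊎_)
open import Data.Unit using (⊤)
open import Data.Empty using (⊥)
open import Relation.Nullary using (¬_)
open import Relation.Binary.PropositionalEquality using (_≡_)

Subset : Set₁
Subset = ℕ → Set

_⊆_ : Subset → Subset → Set
A ⊆ B = ∀ n → A n → B n

full : Subset
full _ = ⊤

empty : Subset
empty _ = ⊥

∁ : Subset → Subset
∁ A n = ¬ A n

_∩_ : Subset → Subset → Subset
(A ∩ B) n = A n × B n

_∖_ : Subset → Subset → Subset
(A ∖ B) n = A n × ¬ B n

Family : Set₁
Family = Subset → Set

record IsFilter (F : Family) : Set₁ where
  field
    full∈   : F full
    empty∉  : ¬ F empty
    upward  : ∀ {A B} → A ⊆ B → F A → F B
    inter   : ∀ {A B} → F A → F B → F (A ∩ B)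

record IsUltrafilter (U : Family) : Set₁ where
  field
    isFilter : IsFilter U
    ultra    : ∀ A → U A ⊎ U (∁ A)

⋂ : ∀ {n} → (Fin n → Family) → Family
⋂ U A = ∀ j → U j A

dual : Family → Family
dual F A = F (∁ A)

PseudoIntersectionProperty : Family → Family → Set₁
PseudoIntersectionProperty U I =
  (X : ℕ → Subset) → (∀ k → U (X k)) →
  Σ Subset λ Y → U Y × (∀ k → I (Y ∖ X k))

record Ord : Set₂ where
  field
    Carrier : Set₁
    _≤_     : Carrier → Carrier → Set

open Ord public

revOrd : Family → Ord
revOrd U = record { Carrier = Σ Subset U ; _≤_ = λ A B → proj₁ B ⊆ proj₁ A }

incOrd : Family → Ord
incOrd I = record { Carrier = Σ Subset I ; _≤_ = λ A B → proj₁ A ⊆ proj₁ B }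

_^ω : Ord → Ord
P ^ω = record { Carrier = ℕ → Carrier P ; _≤_ = λ f g → ∀ k → _≤_ P (f k) (g k) }

_×O_ : Ord → Ord → Ord
P ×O Q = record { Carrier = Carrier P × Carrier Q
                ; _≤_ = λ a b → _≤_ P (proj₁ a) (proj₁ b) × _≤_ Q (proj₂ a) (proj₂ b) }

Cofinal : (P : Ord) → (Carrier P → Set₁) → Set₁
Cofinal P C = ∀ p → Σ (Carrier P) λ q → C q × _≤_ P p q

_≤T_ : Ord → Ord → Set₂
P ≤T Q = Σ (Carrier Q → Carrier P) λ f →
  (C : Carrier Q → Set₁) → Cofinal Q C →
  Cofinal P (λ p → Σ (Carrier Q) λ q → C q × f q ≡ p)

-- For each j pick Z_j ∈ U_i: all of ω if every X_k lies in U_j, otherwise some X_k ∉ U_j.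
-- Then Y = ⋂_j Z_j ∈ U_i, and for each j either X_k ∈ U_j is disjoint from Y ∖ X_k, or
-- Y ⊆ Z_j ∉ U_j and so ω ∖ Y ∈ U_j; either way Y ∖ X_k ∈ U_j*.
module Submission where

open import Defs
open import Level using (0ℓ; suc; lift; lower)
open import Axiom.ExcludedMiddle using (ExcludedMiddle)
open import Axiom.DoubleNegationElimination using (DoubleNegationElimination; em⇒dne)
open import Data.Nat using (ℕ)
open import Data.Fin using (Fin)
open import Data.Product using (_×_; Σ; _,_; proj₁; proj₂)
open import Data.Sum using (_⊎_; inj₁; inj₂)
open import Data.Empty using (⊥-elim)
open import Relation.Nullary using (¬_; yes; no)
open import Relation.Nullary.Decidable using (map′)
open import Relation.Binary.PropositionalEquality using (_≡_; refl)

em-lower : ExcludedMiddle (suc 0ℓ) → ExcludedMiddle 0ℓ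
em-lower em = map′ lower lift em

∀⊎∃¬ : ExcludedMiddle 0ℓ → {A : Set} (P : A → Set) → (∀ a → P a) ⊎ Σ A (λ a → ¬ P a)
∀⊎∃¬ em P with em {Σ _ λ a → ¬ P a}
... | yes counterexample = inj₂ counterexample
... | no none             = inj₁ λ a → em⇒dne em λ ¬Pa → none (a , ¬Pa)

filter-⋂-closed : ∀ {F} → IsFilter F → (n : ℕ) (Z : Fin n → Subset) →
                  (∀ j → F (Z j)) → F (λ m → ∀ j → Z j m)
filter-⋂-closed fF ℕ.zero    Z Z∈F = IsFilter.upward fF (λ m _ ()) (IsFilter.full∈ fF)
filter-⋂-closed {F} fF (ℕ.suc n) Z Z∈F =
  IsFilter.upward fF cons (IsFilter.inter fF (Z∈F Fin.zero) tail∈F)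
  where
  tail∈F : F (λ m → ∀ j → Z (Fin.suc j) m)
  tail∈F = filter-⋂-closed fF n (λ j → Z (Fin.suc j)) (λ j → Z∈F (Fin.suc j))
  cons : ∀ m → Z Fin.zero m × (∀ j → Z (Fin.suc j) m) → ∀ j → Z j m
  cons m (z₀ , zs) Fin.zero    = z₀
  cons m (z₀ , zs) (Fin.suc j) = zs j

ultrafilter-∁ : ∀ {U A} → IsUltrafilter U → ¬ U A → U (∁ A)
ultrafilter-∁ {A = A} uU A∉U with IsUltrafilter.ultra uU A
... | inj₁ A∈U  = ⊥-elim (A∉U A∈U)
... | inj₂ ∁A∈U = ∁A∈U

filter-pip-dual-⋂-ultrafilters : ExcludedMiddle 0ℓ → ∀ {F} → IsFilter F →
  (n : ℕ) (U : Fin n → Family) → (∀ j → IsUltrafilter (U j)) →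
  PseudoIntersectionProperty F (dual (⋂ U))
filter-pip-dual-⋂-ultrafilters em {F} fF n U uU X X∈F = Y , Y∈F , Y∖X∈dual
  where
  upward : ∀ j {A B} → A ⊆ B → U j A → U j B
  upward j = IsFilter.upward (IsUltrafilter.isFilter (uU j))

  witness : ∀ j → Σ Subset λ Z → F Z × ((∀ k → U j (X k)) ⊎ ¬ U j Z)
  witness j with ∀⊎∃¬ em (λ k → U j (X k))
  ... | inj₁ all∈      = full , IsFilter.full∈ fF , inj₁ all∈
  ... | inj₂ (k , X∉U) = X k , X∈F k , inj₂ X∉U

  Z : Fin n → Subset
  Z j = proj₁ (witness j)

  Y : Subset
  Y m = ∀ j → Z j m

  Y∈F : F Y
  Y∈F = filter-⋂-closed fF n Z (λ j → proj₁ (proj₂ (witness j)))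

  Y∖X∈dual : ∀ k → dual (⋂ U) (Y ∖ X k)
  Y∖X∈dual k j with proj₂ (proj₂ (witness j))
  ... | inj₁ all∈ = upward j (λ m x (_ , ¬x) → ¬x x) (all∈ k)
  ... | inj₂ Z∉U  = upward j (λ m ¬y (y , _) → ¬y y)
                      (ultrafilter-∁ (uU j) λ Y∈U → Z∉U (upward j (λ m y → y j) Y∈U))

revOrd^ω≤T-revOrd×dual^ω : DoubleNegationElimination 0ℓ → ∀ {F G} → IsFilter F →
  (∀ A → G A → F A) → PseudoIntersectionProperty F (dual G) →
  (revOrd F ^ω) ≤T (revOrd F ×O (incOrd (dual G) ^ω))
revOrd^ω≤T-revOrd×dual^ω dne {F} {G} fF G⊆F pip = f , f-cofinal
  where
  f : Carrier (revOrd F ×O (incOrd (dual G) ^ω)) → Carrier (revOrd F ^ω)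
  f ((A , A∈F) , B) k = A ∖ proj₁ (B k) , IsFilter.inter fF A∈F (G⊆F _ (proj₂ (B k)))

  f-cofinal : (C : Carrier (revOrd F ×O (incOrd (dual G) ^ω)) → Set₁) →
    Cofinal (revOrd F ×O (incOrd (dual G) ^ω)) C →
    Cofinal (revOrd F ^ω) (λ p → Σ _ λ q → C q × f q ≡ p)
  f-cofinal C C-cofinal X
    with (Y , Y∈F , Y∖X∈dual) ← pip (λ k → proj₁ (X k)) (λ k → proj₂ (X k))
    with (q , q∈C , A⊆Y , Y∖X⊆B) ← C-cofinal ((Y , Y∈F) , λ k → Y ∖ proj₁ (X k) , Y∖X∈dual k)
    = f q , (q , q∈C , refl) ,
      λ k m (a , ¬b) → dne λ ¬x → ¬b (Y∖X⊆B k m (A⊆Y m a , ¬x))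

theorem3p13 : ExcludedMiddle (suc 0ℓ) →
    (n : ℕ) (U : Fin n → Family) → (∀ j → IsUltrafilter (U j)) →
    (i : Fin n) →
    PseudoIntersectionProperty (U i) (dual (⋂ U))
      × ((revOrd (U i) ^ω) ≤T (revOrd (U i) ×O (incOrd (dual (⋂ U)) ^ω)))
theorem3p13 em₁ n U uU i =
  pip , revOrd^ω≤T-revOrd×dual^ω (em⇒dne em) {G = ⋂ U} Uᵢ-filter (λ A A∈⋂ → A∈⋂ i) pip
  where
  em : ExcludedMiddle 0ℓ
  em = em-lower em₁
  Uᵢ-filter : IsFilter (U i)
  Uᵢ-filter = IsUltrafilter.isFilter (uU i)
  pip : PseudoIntersectionProperty (U i) (dual (⋂ U))
  pip = filter-pip-dual-⋂-ultrafilters em Uᵢ-filter n U uU
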